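{- Let $A$ be a $d$-dimensional polystochastic matrix of order $n$, let $1\le m\le d-1$ and fix positions $1\le i_1<\dots<i_m\le d$. For $\beta\in\{0,\dots,n-1\}^m$ let $\Gamma^\beta$ be the $(d-m)$-dimensional plane of $A$ obtained by fixing coordinates $i_1,\dots,i_m$ to the values $\beta_1,\dots,\beta_m$. For vectors $\beta^1,\dots,\beta^n\in\{0,\dots,n-1\}^m$ that are pairwise diagonally located (i.e. $\beta^j$ and $\beta^l$ differ in every coordinate for $j\ne l$), let $R(\beta^1,\dots,\beta^n)$ be the $(d-m+1)$-dimensional matrix of order $n$ whose $j$-th hyperplane of the first direction ($j=0,\dots,n-1$) is $\Gamma^{\beta^{j+1}}$. Then: (1) $\operatorname{per}A>0$ if and only if there exist pairwise diagonally located $\beta^1,\dots,\beta^n$ with $\operatorname{per}R(\beta^1,\dots,\beta^n)>0$; (2) $\operatorname{per}A=0$ if and only if $\operatorname{per}R(\beta^1,\dots,\beta^n)=0$ for all pairwise diagonally located $\beta^1,\dots,\beta^n$.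
   Context: A $d$-dimensional matrix of order $n$ is an array $A=(a_\alpha)_{\alpha\in\{0,\dots,n-1\}^d}$. A $k$-dimensional plane is obtained by fixing $d-k$ coordinates and letting the other $k$ range over $\{0,\dots,n-1\}$; lines are $1$-dimensional planes. $A$ is polystochastic if its entries are nonnegative and every line sums to $1$. A diagonal is a set of $n$ indices pairwise differing in every coordinate; $\operatorname{per}A=\sum_D\prod_{\alpha\in D}a_\alpha$ over all diagonals.
   Formalization: The polystochastic matrix A has rational entries instead of real ones. -}

module Defs where

open import Data.Bool using (Bool; true; false; if_then_else_; not; _∧_; _∨_)
open import Data.Nat using (ℕ; zero; suc)
open import Data.Fin using (Fin)
open import Data.Fin.Properties using () renaming (_≟_ to _≟ᶠ_)
open import Data.Vec using (Vec; []; _∷_; lookup; _[_]≔_)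
open import Data.List using (List; [_]; map; concatMap; foldr; allFin)
open import Data.Product using (_×_)
open import Data.Rational using (ℚ; 0ℚ; 1ℚ; _+_; _*_; _≤_)
open import Data.Empty using (⊥)
open import Relation.Binary.PropositionalEquality using (_≡_; _≢_)
open import Relation.Nullary.Decidable using (⌊_⌋)

Index : ℕ → ℕ → Set
Index d n = Vec (Fin n) d

Matrix : ℕ → ℕ → Set
Matrix d n = Index d n → ℚ

sumℚ : List ℚ → ℚ
sumℚ = foldr _+_ 0ℚ

prodℚ : List ℚ → ℚ
prodℚ = foldr _*_ 1ℚ

allVecsOf : {B : Set} → List B → (k : ℕ) → List (Vec B k)
allVecsOf xs zero    = [ [] ]
allVecsOf xs (suc k) = concatMap (λ x → map (x ∷_) (allVecsOf xs k)) xs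

allIndices : (d n : ℕ) → List (Index d n)
allIndices d n = allVecsOf (allFin n) d

Polystochastic : {d n : ℕ} → Matrix d n → Set
Polystochastic {d} {n} A =
  (∀ (α : Index d n) → 0ℚ ≤ A α) ×
  (∀ (k : Fin d) (α : Index d n) → sumℚ (map (λ t → A (α [ k ]≔ t)) (allFin n)) ≡ 1ℚ)

DiagonallyLocated : {m n : ℕ} → (Fin n → Vec (Fin n) m) → Set
DiagonallyLocated {m} {n} D =
  ∀ (j l : Fin n) → j ≢ l → ∀ (k : Fin m) → lookup (D j) k ≢ lookup (D l) k

allB : {B : Set} → (B → Bool) → List B → Bool
allB f = foldr (λ x b → f x ∧ b) true

isDiagonal : {m n : ℕ} → (Fin n → Vec (Fin n) m) → Bool
isDiagonal {m} {n} D =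
  allB (λ j → allB (λ l → ⌊ j ≟ᶠ l ⌋ ∨
         allB (λ k → not ⌊ lookup (D j) k ≟ᶠ lookup (D l) k ⌋) (allFin m))
       (allFin n)) (allFin n)

-- For d ≥ 1 every diagonal (a set of n indices) is listed exactly once by
-- ordering its elements by their first coordinate: D j = j ∷ T j.
-- For d = 0 there is one index; a diagonal (n distinct indices) exists
-- iff n ≤ 1.
per : {d n : ℕ} → Matrix d n → ℚ
per {zero} {zero}        A = 1ℚ
per {zero} {suc zero}    A = A []
per {zero} {suc (suc _)} A = 0ℚ
per {suc d} {n} A =
  sumℚ (map (λ T → let D = λ (j : Fin n) → j ∷ lookup T j in
                   if isDiagonal D then prodℚ (map (λ j → A (D j)) (allFin n)) else 0ℚ)
            (allVecsOf (allIndices d n) n))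

-- The set of fixed positions {i_1 < … < i_m} ⊆ {1,…,d} is given as a mask
-- p : Vec Bool d (true = fixed); nT p = m, nF p = d - m.
nT : {d : ℕ} → Vec Bool d → ℕ
nT []          = zero
nT (true ∷ p)  = suc (nT p)
nT (false ∷ p) = nT p

nF : {d : ℕ} → Vec Bool d → ℕ
nF []          = zero
nF (true ∷ p)  = nF p
nF (false ∷ p) = suc (nF p)

merge : {d n : ℕ} (p : Vec Bool d) → Vec (Fin n) (nT p) → Vec (Fin n) (nF p) → Index d n
merge []          []       []       = []
merge (true ∷ p)  (b ∷ bs) gs       = b ∷ merge p bs gs
merge (false ∷ p) bs       (g ∷ gs) = g ∷ merge p bs gs

Γ : {d n : ℕ} (p : Vec Bool d) → Matrix d n → Vec (Fin n) (nT p) → Matrix (nF p) n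
Γ p A β γ = A (merge p β γ)

-- R(β^1,…,β^n): (d-m+1)-dimensional matrix whose j-th hyperplane in the first
-- direction is Γ^{β^{j+1}}  (βs j plays the role of β^{j+1})
R : {d n : ℕ} (p : Vec Bool d) → Matrix d n → (Fin n → Vec (Fin n) (nT p)) → Matrix (suc (nF p)) n
R p A βs (j ∷ γ) = Γ p A (βs j) γ

{-# OPTIONS --safe #-}
-- A nonnegative matrix of positive dimension has positive permanent iff it has a diagonal
-- with all entries positive, per A being a sum of products of nonnegative entries.
-- Splitting every index of such a diagonal into its fixed coordinates β and its free
-- coordinates γ yields diagonally located β^1,…,β^n together with the positive diagonal
-- {(j, γ_j)} of R(β^1,…,β^n); merging β^j back into (j, γ) inverts this. Part (2) is the
-- negation of part (1), all permanents involved being nonnegative. Hence only the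
-- nonnegativity of A is needed; the hypothesis 1 ≤ m serves only to exclude d = 0, where
-- per is given by a separate clause.
module Submission where

open import Defs
open import Data.Bool using (Bool; true; false; _∨_; not; if_then_else_)
open import Data.Nat using (ℕ; zero; suc; _∸_) renaming (_≤_ to _≤ℕ_)
import Data.Nat.Properties as ℕ
open import Data.Fin using (Fin; punchOut) renaming (zero to fzero)
open import Data.Fin.Properties using (any?; punchOut-injective; injective⇒≤) renaming (_≟_ to _≟ᶠ_)
open import Data.Vec using (Vec; []; _∷_; lookup; tabulate; tail)
open import Data.Vec.Properties using (lookup∘tabulate)
open import Data.Vec.Relation.Binary.Pointwise.Inductive as Pointwise using (Pointwise; []; _∷_)
open import Data.Vec.Relation.Binary.Pointwise.Extensional using (ext; extensional⇒inductive)
open import Data.List using (List; []; _∷_; map; allFin)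
open import Data.List.Membership.Propositional using (_∈_; lose)
open import Data.List.Membership.Propositional.Properties using (∈-allFin; ∈-map⁺; ∈-concatMap⁺)
open import Data.List.Relation.Unary.All using (All; []; _∷_)
open import Data.List.Relation.Unary.All.Properties using (tabulate⁺; tabulate⁻)
open import Data.List.Relation.Unary.Any as Any using (Any; here; there)
open import Data.Rational using (ℚ; 0ℚ; 1ℚ; _+_; _*_; _<_; _≤_; positive; nonNegative)
import Data.Rational.Properties as ℚ
open import Data.Product using (_×_; _,_; proj₁; proj₂; ∃; Σ-syntax)
open import Data.Sum using (_⊎_; inj₁; inj₂; [_,_]′)
open import Function using (_∘_)
open import Function.Bundles using (_⇔_; mk⇔; Equivalence)
open import Function.Definitions using (Injective; StrictlySurjective)
open import Relation.Nullary using (¬_; yes; no; contradiction)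
open import Relation.Nullary.Decidable using (⌊_⌋)
open import Relation.Binary using (Rel)
open import Relation.Binary.PropositionalEquality using (_≡_; _≢_; refl; sym; trans; cong; subst; subst₂)

open Equivalence using (to; from)

nonNeg⇒≡0⊎pos : ∀ {a} → 0ℚ ≤ a → a ≡ 0ℚ ⊎ 0ℚ < a
nonNeg⇒≡0⊎pos {a} 0≤a with 0ℚ ℚ.<? a
... | yes 0<a = inj₂ 0<a
... | no 0≮a = inj₁ (ℚ.≤-antisym (ℚ.≮⇒≥ 0≮a) 0≤a)

nonNeg-≡0⇔≯0 : ∀ {a} → 0ℚ ≤ a → a ≡ 0ℚ ⇔ (¬ 0ℚ < a)
nonNeg-≡0⇔≯0 0≤a = mk⇔ (λ { refl → ℚ.<-irrefl refl }) (λ 0≮a → ℚ.≤-antisym (ℚ.≮⇒≥ 0≮a) 0≤a)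

*-nonNeg : ∀ {a b} → 0ℚ ≤ a → 0ℚ ≤ b → 0ℚ ≤ a * b
*-nonNeg {a} {b} 0≤a 0≤b = ℚ.nonNegative⁻¹ (a * b)
  {{ℚ.nonNeg*nonNeg⇒nonNeg a {{nonNegative 0≤a}} b {{nonNegative 0≤b}}}}

+-pos⇔ : ∀ {a b} → 0ℚ ≤ a → 0ℚ ≤ b → 0ℚ < a + b ⇔ (0ℚ < a ⊎ 0ℚ < b)
+-pos⇔ {a} {b} 0≤a 0≤b = mk⇔ split join
  where
  split : 0ℚ < a + b → 0ℚ < a ⊎ 0ℚ < b
  split 0<a+b with nonNeg⇒≡0⊎pos 0≤a
  ... | inj₂ 0<a = inj₁ 0<a
  ... | inj₁ refl = inj₂ (subst (0ℚ <_) (ℚ.+-identityˡ b) 0<a+b)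
  join : 0ℚ < a ⊎ 0ℚ < b → 0ℚ < a + b
  join (inj₁ 0<a) = ℚ.+-mono-<-≤ 0<a 0≤b
  join (inj₂ 0<b) = ℚ.+-mono-≤-< 0≤a 0<b

*-pos⇔ : ∀ {a b} → 0ℚ ≤ a → 0ℚ ≤ b → 0ℚ < a * b ⇔ (0ℚ < a × 0ℚ < b)
*-pos⇔ {a} {b} 0≤a 0≤b = mk⇔ split join
  where
  split : 0ℚ < a * b → 0ℚ < a × 0ℚ < b
  split 0<ab with nonNeg⇒≡0⊎pos 0≤a | nonNeg⇒≡0⊎pos 0≤b
  ... | inj₂ 0<a | inj₂ 0<b = 0<a , 0<b
  ... | inj₁ refl | _ = contradiction (sym (ℚ.*-zeroˡ b)) (ℚ.<⇒≢ 0<ab)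
  ... | _ | inj₁ refl = contradiction (sym (ℚ.*-zeroʳ a)) (ℚ.<⇒≢ 0<ab)
  join : 0ℚ < a × 0ℚ < b → 0ℚ < a * b
  join (0<a , 0<b) = ℚ.positive⁻¹ (a * b) {{ℚ.pos*pos⇒pos a {{positive 0<a}} b {{positive 0<b}}}}

module _ {B : Set} {f : B → ℚ} (f≥0 : ∀ x → 0ℚ ≤ f x) where

  sum-nonNeg : ∀ xs → 0ℚ ≤ sumℚ (map f xs)
  sum-nonNeg []       = ℚ.≤-refl
  sum-nonNeg (x ∷ xs) = ℚ.+-mono-≤ (f≥0 x) (sum-nonNeg xs)

  sum-pos⇔ : ∀ xs → 0ℚ < sumℚ (map f xs) ⇔ Any (λ x → 0ℚ < f x) xs
  sum-pos⇔ []       = mk⇔ (λ 0<0 → contradiction refl (ℚ.<⇒≢ 0<0)) λ ()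
  sum-pos⇔ (x ∷ xs) = mk⇔
    ([ here , there ∘ to (sum-pos⇔ xs) ]′ ∘ to head-or-rest)
    (from head-or-rest ∘ λ { (here 0<fx) → inj₁ 0<fx ; (there any) → inj₂ (from (sum-pos⇔ xs) any) })
    where
    head-or-rest : 0ℚ < f x + sumℚ (map f xs) ⇔ (0ℚ < f x ⊎ 0ℚ < sumℚ (map f xs))
    head-or-rest = +-pos⇔ (f≥0 x) (sum-nonNeg xs)

  prod-nonNeg : ∀ xs → 0ℚ ≤ prodℚ (map f xs)
  prod-nonNeg []       = ℚ.<⇒≤ (ℚ.positive⁻¹ 1ℚ)
  prod-nonNeg (x ∷ xs) = *-nonNeg (f≥0 x) (prod-nonNeg xs)

  prod-pos⇔ : ∀ xs → 0ℚ < prodℚ (map f xs) ⇔ All (λ x → 0ℚ < f x) xs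
  prod-pos⇔ []       = mk⇔ (λ _ → []) (λ _ → ℚ.positive⁻¹ 1ℚ)
  prod-pos⇔ (x ∷ xs) = mk⇔
    (λ 0<Π → let (0<fx , 0<Π′) = to (*-pos⇔ (f≥0 x) (prod-nonNeg xs)) 0<Π
             in 0<fx ∷ to (prod-pos⇔ xs) 0<Π′)
    (λ { (0<fx ∷ all) → from (*-pos⇔ (f≥0 x) (prod-nonNeg xs)) (0<fx , from (prod-pos⇔ xs) all) })

allB-allFin : ∀ {n} (f : Fin n → Bool) → allB f (allFin n) ≡ true ⇔ (∀ i → f i ≡ true)
allB-allFin {n} f = mk⇔ (tabulate⁻ ∘ allB⇒All (allFin n)) (All⇒allB (allFin n) ∘ tabulate⁺)
  where
  allB⇒All : ∀ xs → allB f xs ≡ true → All (λ x → f x ≡ true) xs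
  allB⇒All []       _ = []
  allB⇒All (x ∷ xs) e with f x in fx
  ... | true = fx ∷ allB⇒All xs e
  All⇒allB : ∀ xs → All (λ x → f x ≡ true) xs → allB f xs ≡ true
  All⇒allB []            []          = refl
  All⇒allB (x ∷ xs) (fx ∷ all) rewrite fx = All⇒allB xs all

≟-∨-true⇔ : ∀ {n} (i j : Fin n) {b} → ⌊ i ≟ᶠ j ⌋ ∨ b ≡ true ⇔ (i ≢ j → b ≡ true)
≟-∨-true⇔ i j with i ≟ᶠ j
... | yes i≡j = mk⇔ (λ _ i≢j → contradiction i≡j i≢j) (λ _ → refl)
... | no i≢j  = mk⇔ (λ b≡true _ → b≡true) (λ h → h i≢j)

not-≟-true⇔ : ∀ {n} (i j : Fin n) → not ⌊ i ≟ᶠ j ⌋ ≡ true ⇔ (i ≢ j)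
not-≟-true⇔ i j with i ≟ᶠ j
... | yes i≡j = mk⇔ (λ ()) (λ i≢j → contradiction i≡j i≢j)
... | no i≢j  = mk⇔ (λ _ → i≢j) (λ _ → refl)

isDiagonal⇔ : ∀ {m n} (D : Fin n → Vec (Fin n) m) → isDiagonal D ≡ true ⇔ DiagonallyLocated D
isDiagonal⇔ D = mk⇔
  (λ isDiag j l j≢l k →
     let pair = to (allB-allFin _) (to (allB-allFin _) isDiag j) l
     in to (not-≟-true⇔ _ _) (to (allB-allFin _) (to (≟-∨-true⇔ j l) pair j≢l) k))
  (λ dl → from (allB-allFin _) λ j → from (allB-allFin _) λ l → from (≟-∨-true⇔ j l) λ j≢l →
     from (allB-allFin _) λ k → from (not-≟-true⇔ _ _) (dl j l j≢l k))

∈-allVecsOf : ∀ {B : Set} {xs : List B} → (∀ x → x ∈ xs) → ∀ {k} (v : Vec B k) → v ∈ allVecsOf xs k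
∈-allVecsOf x∈xs []      = here refl
∈-allVecsOf {xs = xs} x∈xs {suc k} (x ∷ v) =
  ∈-concatMap⁺ (λ y → map (y ∷_) (allVecsOf xs k)) (Any.map (λ { refl → ∈-map⁺ (x ∷_) (∈-allVecsOf x∈xs v) }) (x∈xs x))

∈-allIndices : ∀ {d n} (α : Index d n) → α ∈ allIndices d n
∈-allIndices = ∈-allVecsOf ∈-allFin

injective⇒strictlySurjective : ∀ {n} {f : Fin n → Fin n} → Injective _≡_ _≡_ f → StrictlySurjective _≡_ f
injective⇒strictlySurjective {suc n} {f} f-inj k with any? (λ i → f i ≟ᶠ k)
... | yes hit = hit
... | no miss = contradiction (injective⇒≤ g-inj) (ℕ.<-irrefl refl)
  where
  f≢k : ∀ i → k ≢ f i
  f≢k i k≡fi = miss (i , sym k≡fi)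
  g : Fin (suc n) → Fin n
  g i = punchOut (f≢k i)
  g-inj : Injective _≡_ _≡_ g
  g-inj {i} {j} gi≡gj = f-inj (punchOut-injective (f≢k i) (f≢k j) gi≡gj)

NonNegative : ∀ {d n} → Matrix d n → Set
NonNegative A = ∀ α → 0ℚ ≤ A α

record IsPositiveDiagonal {d n} (A : Matrix d n) (D : Fin n → Index d n) : Set where
  constructor _,_
  field
    diagonallyLocated : DiagonallyLocated D
    positiveEntries   : ∀ j → 0ℚ < A (D j)

open IsPositiveDiagonal

PositiveDiagonal : ∀ {d n} → Matrix d n → Set
PositiveDiagonal A = ∃ (IsPositiveDiagonal A)

module _ {d n} {A : Matrix d n} where

  isPositiveDiagonal-cong : ∀ {D E : Fin n → Index d n} →
    (∀ j → D j ≡ E j) → IsPositiveDiagonal A D → IsPositiveDiagonal A E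
  isPositiveDiagonal-cong D≡E (dl , pos) =
    (λ j l j≢l k → subst₂ (λ u v → lookup u k ≢ lookup v k) (D≡E j) (D≡E l) (dl j l j≢l k)) ,
    (λ j → subst (λ α → 0ℚ < A α) (D≡E j) (pos j))

  isPositiveDiagonal-∘ : ∀ {D : Fin n → Index d n} {π : Fin n → Fin n} →
    Injective _≡_ _≡_ π → IsPositiveDiagonal A D → IsPositiveDiagonal A (D ∘ π)
  isPositiveDiagonal-∘ π-inj (dl , pos) = (λ j l j≢l → dl _ _ (j≢l ∘ π-inj)) , pos ∘ _

reindexByFirstCoordinate : ∀ {d n} (D : Fin n → Index (suc d) n) → DiagonallyLocated D →
  Σ[ π ∈ (Fin n → Fin n) ] Injective _≡_ _≡_ π × (∀ j → D (π j) ≡ j ∷ tail (D (π j)))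
reindexByFirstCoordinate {n = n} D dl = π , π-injective , D∘π≡
  where
  first : Fin n → Fin n
  first j = lookup (D j) fzero

  first-injective : Injective _≡_ _≡_ first
  first-injective {j} {l} e with j ≟ᶠ l
  ... | yes j≡l = j≡l
  ... | no j≢l  = contradiction e (dl j l j≢l fzero)

  π : Fin n → Fin n
  π = proj₁ ∘ injective⇒strictlySurjective first-injective

  first∘π : ∀ j → first (π j) ≡ j
  first∘π = proj₂ ∘ injective⇒strictlySurjective first-injective

  π-injective : Injective _≡_ _≡_ π
  π-injective {j} {l} πj≡πl = trans (sym (first∘π j)) (trans (cong first πj≡πl) (first∘π l))

  D∘π≡ : ∀ j → D (π j) ≡ j ∷ tail (D (π j))
  D∘π≡ j with D (π j) | first∘π j
  ... | x ∷ α | refl = refl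

module _ {d n} {A : Matrix (suc d) n} (A≥0 : NonNegative A) where

  -- per A unfolds to the sum of diagonalTerm T over all T : Vec (Index d n) n.
  private
    diagonalTerm : Vec (Index d n) n → ℚ
    diagonalTerm T = if isDiagonal (λ j → j ∷ lookup T j)
                     then prodℚ (map (λ j → A (j ∷ lookup T j)) (allFin n)) else 0ℚ

    diagonalTerm-nonNeg : ∀ T → 0ℚ ≤ diagonalTerm T
    diagonalTerm-nonNeg T with isDiagonal (λ j → j ∷ lookup T j)
    ... | true  = prod-nonNeg (λ j → A≥0 _) (allFin n)
    ... | false = ℚ.≤-refl

    diagonalTerm-pos⇔ : ∀ T → 0ℚ < diagonalTerm T ⇔ IsPositiveDiagonal A (λ j → j ∷ lookup T j)
    diagonalTerm-pos⇔ T with isDiagonal (λ j → j ∷ lookup T j) in isDiag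
    ... | true  = mk⇔
      (λ 0<Π → to (isDiagonal⇔ (λ j → j ∷ lookup T j)) isDiag ,
               tabulate⁻ (to (prod-pos⇔ (λ j → A≥0 _) (allFin n)) 0<Π))
      (from (prod-pos⇔ (λ j → A≥0 _) (allFin n)) ∘ tabulate⁺ ∘ positiveEntries)
    ... | false = mk⇔
      (λ 0<0 → contradiction refl (ℚ.<⇒≢ 0<0))
      (λ (dl , _) → contradiction (trans (sym isDiag) (from (isDiagonal⇔ (λ j → j ∷ lookup T j)) dl)) λ ())

    per-pos⇔any : 0ℚ < per A ⇔ Any (λ T → 0ℚ < diagonalTerm T) (allVecsOf (allIndices d n) n)
    per-pos⇔any = sum-pos⇔ diagonalTerm-nonNeg (allVecsOf (allIndices d n) n)

  per-nonNeg : 0ℚ ≤ per A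
  per-nonNeg = sum-nonNeg diagonalTerm-nonNeg (allVecsOf (allIndices d n) n)

  per-pos⇔positiveDiagonal : 0ℚ < per A ⇔ PositiveDiagonal A
  per-pos⇔positiveDiagonal = mk⇔ positiveTerm⇒diagonal diagonal⇒positiveTerm
    where
    positiveTerm⇒diagonal : 0ℚ < per A → PositiveDiagonal A
    positiveTerm⇒diagonal 0<per with Any.satisfied (to per-pos⇔any 0<per)
    ... | T , 0<term = _ , to (diagonalTerm-pos⇔ T) 0<term

    -- per lists each diagonal once, sorted by first coordinate, so D is first brought into that form.
    diagonal⇒positiveTerm : PositiveDiagonal A → 0ℚ < per A
    diagonal⇒positiveTerm (D , isPD) with reindexByFirstCoordinate D (diagonallyLocated isPD)
    ... | π , π-injective , D∘π≡ =
      from per-pos⇔any (lose (∈-allVecsOf ∈-allIndices T) (from (diagonalTerm-pos⇔ T) isPD′))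
      where
      T : Vec (Index d n) n
      T = tabulate (tail ∘ D ∘ π)
      isPD′ : IsPositiveDiagonal A (λ j → j ∷ lookup T j)
      isPD′ = isPositiveDiagonal-cong
        (λ j → trans (D∘π≡ j) (cong (j ∷_) (sym (lookup∘tabulate (tail ∘ D ∘ π) j))))
        (isPositiveDiagonal-∘ π-injective isPD)

fixed : ∀ {d n} (p : Vec Bool d) → Index d n → Vec (Fin n) (nT p)
fixed []          []      = []
fixed (true ∷ p)  (a ∷ α) = a ∷ fixed p α
fixed (false ∷ p) (a ∷ α) = fixed p α

free : ∀ {d n} (p : Vec Bool d) → Index d n → Vec (Fin n) (nF p)
free []          []      = []
free (true ∷ p)  (a ∷ α) = free p α
free (false ∷ p) (a ∷ α) = a ∷ free p α

merge-fixed-free : ∀ {d n} (p : Vec Bool d) (α : Index d n) → merge p (fixed p α) (free p α) ≡ α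
merge-fixed-free []          []      = refl
merge-fixed-free (true ∷ p)  (a ∷ α) = cong (a ∷_) (merge-fixed-free p α)
merge-fixed-free (false ∷ p) (a ∷ α) = cong (a ∷_) (merge-fixed-free p α)

module _ {n ℓ} {_∼_ : Rel (Fin n) ℓ} where

  merge⁺ : ∀ {d} (p : Vec Bool d) {β β′ γ γ′} → Pointwise _∼_ β β′ → Pointwise _∼_ γ γ′ →
           Pointwise _∼_ (merge p β γ) (merge p β′ γ′)
  merge⁺ []          []         []         = []
  merge⁺ (true ∷ p)  (b∼b′ ∷ β∼) γ∼        = b∼b′ ∷ merge⁺ p β∼ γ∼
  merge⁺ (false ∷ p) β∼         (g∼g′ ∷ γ∼) = g∼g′ ∷ merge⁺ p β∼ γ∼

  fixed⁺ : ∀ {d} (p : Vec Bool d) {α α′} → Pointwise _∼_ α α′ → Pointwise _∼_ (fixed p α) (fixed p α′)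
  fixed⁺ []          []         = []
  fixed⁺ (true ∷ p)  (a∼a′ ∷ α∼) = a∼a′ ∷ fixed⁺ p α∼
  fixed⁺ (false ∷ p) (_    ∷ α∼) = fixed⁺ p α∼

  free⁺ : ∀ {d} (p : Vec Bool d) {α α′} → Pointwise _∼_ α α′ → Pointwise _∼_ (free p α) (free p α′)
  free⁺ []          []         = []
  free⁺ (true ∷ p)  (_    ∷ α∼) = free⁺ p α∼
  free⁺ (false ∷ p) (a∼a′ ∷ α∼) = a∼a′ ∷ free⁺ p α∼

module _ {m n} {D : Fin n → Vec (Fin n) m} where

  apart : DiagonallyLocated D → ∀ {j l} → j ≢ l → Pointwise _≢_ (D j) (D l)
  apart dl j≢l = extensional⇒inductive (ext (dl _ _ j≢l))

  fromApart : (∀ {j l} → j ≢ l → Pointwise _≢_ (D j) (D l)) → DiagonallyLocated D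
  fromApart D# j l j≢l = Pointwise.lookup (D# j≢l)

module _ {d n} (p : Vec Bool d) (A : Matrix d n) (βs : Fin n → Vec (Fin n) (nT p)) where

  embed : Index (suc (nF p)) n → Index d n
  embed (j ∷ γ) = merge p (βs j) γ

  R≡A∘embed : ∀ v → R p A βs v ≡ A (embed v)
  R≡A∘embed (j ∷ γ) = refl

  embed-apart : DiagonallyLocated βs → ∀ {u v} → Pointwise _≢_ u v → Pointwise _≢_ (embed u) (embed v)
  embed-apart dl (j≢l ∷ γ#γ′) = merge⁺ p (apart dl j≢l) γ#γ′

  R-nonNeg : NonNegative A → NonNegative (R p A βs)
  R-nonNeg A≥0 (j ∷ γ) = A≥0 _

positiveDiagonal⇔R : ∀ {d n} (p : Vec Bool d) {A : Matrix d n} →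
  PositiveDiagonal A ⇔ ∃ (λ βs → DiagonallyLocated βs × PositiveDiagonal (R p A βs))
positiveDiagonal⇔R p {A} = mk⇔ split glue
  where
  split : PositiveDiagonal A → ∃ (λ βs → DiagonallyLocated βs × PositiveDiagonal (R p A βs))
  split (D , (dl , pos)) =
    fixed p ∘ D , fromApart (fixed⁺ p ∘ apart dl) ,
    (λ j → j ∷ free p (D j)) , (fromApart (λ j≢l → j≢l ∷ free⁺ p (apart dl j≢l)) ,
    λ j → subst (λ α → 0ℚ < A α) (sym (merge-fixed-free p (D j))) (pos j))
  glue : ∃ (λ βs → DiagonallyLocated βs × PositiveDiagonal (R p A βs)) → PositiveDiagonal A
  glue (βs , dlβ , D , (dl , pos)) =
    embed p A βs ∘ D , (fromApart (embed-apart p A βs dlβ ∘ apart {D = D} dl) ,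
    λ j → subst (0ℚ <_) (R≡A∘embed p A βs (D j)) (pos j))

module _ {d n} (p : Vec Bool (suc d)) {A : Matrix (suc d) n} (A≥0 : NonNegative A) where

  private
    perR-pos⇔ : ∀ βs → 0ℚ < per (R p A βs) ⇔ PositiveDiagonal (R p A βs)
    perR-pos⇔ βs = per-pos⇔positiveDiagonal (R-nonNeg p A βs A≥0)

    per≡0⇔≯0 : per A ≡ 0ℚ ⇔ (¬ 0ℚ < per A)
    per≡0⇔≯0 = nonNeg-≡0⇔≯0 (per-nonNeg A≥0)

    perR≡0⇔≯0 : ∀ βs → per (R p A βs) ≡ 0ℚ ⇔ (¬ 0ℚ < per (R p A βs))
    perR≡0⇔≯0 βs = nonNeg-≡0⇔≯0 (per-nonNeg (R-nonNeg p A βs A≥0))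

  per-pos⇔R : 0ℚ < per A ⇔ ∃ (λ βs → DiagonallyLocated βs × 0ℚ < per (R p A βs))
  per-pos⇔R = mk⇔
    (λ 0<per → let (βs , dl , pd) = to (positiveDiagonal⇔R p) (to (per-pos⇔positiveDiagonal A≥0) 0<per)
               in βs , dl , from (perR-pos⇔ βs) pd)
    (λ (βs , dl , 0<perR) →
       from (per-pos⇔positiveDiagonal A≥0) (from (positiveDiagonal⇔R p) (βs , dl , to (perR-pos⇔ βs) 0<perR)))

  per≡0⇔R : per A ≡ 0ℚ ⇔ (∀ βs → DiagonallyLocated βs → per (R p A βs) ≡ 0ℚ)
  per≡0⇔R = mk⇔
    (λ per≡0 βs dl → from (perR≡0⇔≯0 βs) λ 0<perR →
       to per≡0⇔≯0 per≡0 (from per-pos⇔R (βs , dl , 0<perR)))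
    (λ perR≡0 → from per≡0⇔≯0 λ 0<per →
       let (βs , dl , 0<perR) = to per-pos⇔R 0<per
       in to (perR≡0⇔≯0 βs) (perR≡0 βs dl) 0<perR)

proposition1 : {d n : ℕ} (A : Matrix d n) (p : Vec Bool d) →
    Polystochastic A → 1 ≤ℕ nT p → nT p ≤ℕ d ∸ 1 →
    ((0ℚ < per A) ⇔ ∃ (λ (βs : Fin n → Vec (Fin n) (nT p)) → DiagonallyLocated βs × 0ℚ < per (R p A βs)))
    × ((per A ≡ 0ℚ) ⇔ (∀ (βs : Fin n → Vec (Fin n) (nT p)) → DiagonallyLocated βs → per (R p A βs) ≡ 0ℚ))
proposition1 {zero}  A [] _         ()  _
proposition1 {suc d} A p (A≥0 , _) _   _ = per-pos⇔R p A≥0 , per≡0⇔R p A≥0
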